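{- Let $T$ be a pre-Galois word of even length that has no Galois root of even length (i.e., $T[1..p_e]$ is not primitive, where $p_e=\mathrm{Per}_e(T)$). Let $p_o=\mathrm{Per}_o(T)$. Then $G_o=T[1..p_o]$ is the odd-length Galois root of $T$ and $T=G_o^kG_o'$ for some integer $k\ge2$ and some prefix $G_o'$ of $G_o$.
   Context: An integer $p\in[1..|W|]$ is a period of $W$ if $W[i+p]=W[i]$ for all $i\in[1..|W|-p]$. $\mathrm{Per}_o(W)$ (resp. $\mathrm{Per}_e(W)$) is the shortest odd (resp. even) period of $W$, set to $|W|+1$ if none exists. A word is primitive if it is not of the form $U^k$ with $k\ge2$. Alternating order: for words $S,T$ with $S^\omega\neq T^\omega$ ($X^\omega$ the infinite repetition of $X$), let $j$ be the first position with $S^\omega[j]\neq T^\omega[j]$; $S\prec_{\mathrm{alt}}T$ if $j$ is odd and $S^\omega[j]<T^\omega[j]$, or $j$ is even and $S^\omega[j]>T^\omega[j]$. $S=_{\mathrm{alt}}T$ if $S^\omega=T^\omega$; $\varepsilon\succ_{\mathrm{alt}}X$ for every nonempty $X$. A word is Galois if it is strictly smaller with respect to $\prec_{\mathrm{alt}}$ than all its other cyclic rotations. A word $T$ is pre-Galois if every proper suffix $S$ of $T$ is a prefix of $T$ or satisfies $S\succ_{\mathrm{alt}}T$. A Galois root of a pre-Galois word $T$ is a prefix $P$ of $T$ such that $|P|$ is a period of $T$ and $P$ is Galois. -}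

module Defs where

open import Level using (Level)
open import Data.Nat using (ℕ; zero; suc; _+_; _≤_; _<_; _%_)
open import Data.Nat.DivMod using (m%n<n)
open import Data.Nat.Divisibility using (_∣_)
open import Data.List using (List; []; _∷_; length; take; drop; _++_; concat; replicate; lookup)
open import Data.Maybe using (Maybe; just; nothing)
open import Data.Fin using (fromℕ<)
open import Data.Product using (Σ; ∃; ∃-syntax; _×_)
open import Data.Sum using (_⊎_)
open import Data.Unit using (⊤)
open import Data.Empty using (⊥)
open import Relation.Nullary using (¬_)
open import Relation.Binary using (Rel)
open import Relation.Binary.PropositionalEquality using (_≡_; _≢_)

Even : ℕ → Set
Even n = 2 ∣ n

Odd : ℕ → Set
Odd n = ¬ (2 ∣ n)

module _ {a : Level} {A : Set a} where

  -- 0-indexed safe access: at W i = W[i+1] (1-indexed).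
  at : List A → ℕ → Maybe A
  at []       _       = nothing
  at (x ∷ xs) zero    = just x
  at (x ∷ xs) (suc i) = at xs i

  Period : List A → ℕ → Set a
  Period W p = (1 ≤ p) × (p ≤ length W)
             × (∀ i → i + p < length W → at W (i + p) ≡ at W i)

  IsPerO : List A → ℕ → Set a
  IsPerO W p = (Odd p × Period W p × (∀ q → Odd q → Period W q → p ≤ q))
             ⊎ ((∀ q → Odd q → ¬ Period W q) × p ≡ suc (length W))

  IsPerE : List A → ℕ → Set a
  IsPerE W p = (Even p × Period W p × (∀ q → Even q → Period W q → p ≤ q))
             ⊎ ((∀ q → Even q → ¬ Period W q) × p ≡ suc (length W))

  _^ʷ_ : List A → ℕ → List A
  U ^ʷ k = concat (replicate k U)

  Primitive : List A → Set a
  Primitive W = ∀ (U : List A) (k : ℕ) → 2 ≤ k → ¬ (W ≡ U ^ʷ k)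

  IsPrefix : List A → List A → Set a
  IsPrefix P T = ∃[ R ] (P ++ R ≡ T)

  rotate : ℕ → List A → List A
  rotate k T = drop k T ++ take k T

  -- (x ∷ xs)^ω at 0-indexed position i.
  ω : A → List A → ℕ → A
  ω x xs i = lookup (x ∷ xs) (fromℕ< (m%n<n i (length (x ∷ xs))))

  module _ {ℓ : Level} (_⊏_ : Rel A ℓ) where

    -- Alternating order S ≺alt T.  0-indexed position i corresponds to
    -- 1-indexed position i+1, so "j odd" becomes "i even".
    -- ε is the maximum; equal infinite powers are incomparable (=alt).
    _≺alt_ : List A → List A → Set (a Level.⊔ ℓ)
    []       ≺alt _        = Level.Lift _ ⊥
    (x ∷ xs) ≺alt []       = Level.Lift _ ⊤
    (x ∷ xs) ≺alt (y ∷ ys) =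
      ∃[ i ] ((∀ k → k < i → ω x xs k ≡ ω y ys k)
             × ((Even i × (ω x xs i ⊏ ω y ys i))
               ⊎ (Odd i × (ω y ys i ⊏ ω x xs i))))

    Galois : List A → Set (a Level.⊔ ℓ)
    Galois T = ∀ k → 0 < k → k < length T → T ≺alt rotate k T

    PreGalois : List A → Set (a Level.⊔ ℓ)
    PreGalois T = ∀ i → 0 < i → i ≤ length T →
                  IsPrefix (drop i T) T ⊎ (T ≺alt drop i T)

    GaloisRoot : List A → List A → Set (a Level.⊔ ℓ)
    GaloisRoot T P = IsPrefix P T × Period T (length P) × Galois P

{-# OPTIONS --safe #-}
module Submission where

-- A word has period p exactly when it is a prefix of the infinite power of its length-p prefix.
-- As |T| is even, pe is a genuine period; writing take pe T as U^k with k ≥ 2 makes |U| a period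
-- of T, odd by the minimality of pe, so 2 po ≤ 2 |U| ≤ pe ≤ |T|. Hence po is the shortest period
-- of T altogether and, with G = take po T, T = G^⌊|T|/po⌋ G′ with exponent at least 2.
-- For 0 < k < po the suffix of T at k is not a prefix of T, so pre-Galoisness gives T ≺alt drop k T,
-- with the first difference inside drop k T. Up to that position T and drop k T agree with G^ω and
-- (rotate k G)^ω, hence G ≺alt rotate k G.

open import Defs
open import Level using (Level; Lift; lift; _⊔_)
open import Data.Nat using (ℕ; zero; suc; _+_; _*_; _∸_; _⊓_; _/_; _%_; _≤_; _<_; z≤n; s≤s; NonZero; >-nonZero; ≢-nonZero⁻¹; _<?_; _≤?_)
open import Data.Nat.Properties
open import Data.Nat.DivMod
open import Data.Nat.Divisibility using (_∣_; divides; _∣?_)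
open import Data.List using (List; []; _∷_; length; take; drop; _++_; lookup)
open import Data.List.Properties using (length-++; length-take; length-drop; take++drop≡id; ++-assoc; ++-identityʳ)
open import Data.Maybe using (Maybe; just; nothing)
open import Data.Maybe.Properties using (just-injective)
open import Data.Fin using (fromℕ<)
open import Data.Product as Product using (∃; ∃-syntax; _×_; _,_; proj₁; proj₂)
open import Data.Sum as Sum using (_⊎_; inj₁; inj₂; [_,_]′)
open import Data.Empty using (⊥; ⊥-elim)
open import Data.Unit using (tt)
open import Function using (_∘_)
open import Relation.Nullary using (¬_; yes; no)
open import Relation.Nullary.Decidable using (decidable-stable)
open import Relation.Binary using (Rel; IsStrictTotalOrder)
open import Relation.Binary.PropositionalEquality

module _ {a : Level} {A : Set a} where

  at-take : ∀ n (xs : List A) {i} → i < n → at (take n xs) i ≡ at xs i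
  at-take (suc n) []       _         = refl
  at-take (suc n) (x ∷ xs) {zero}  _ = refl
  at-take (suc n) (x ∷ xs) {suc i} (s≤s i<n) = at-take n xs i<n

  at-drop : ∀ n (xs : List A) i → at (drop n xs) i ≡ at xs (n + i)
  at-drop zero    xs       i = refl
  at-drop (suc n) []       i = refl
  at-drop (suc n) (x ∷ xs) i = at-drop n xs i

  at-++ˡ : ∀ (xs : List A) {ys i} → i < length xs → at (xs ++ ys) i ≡ at xs i
  at-++ˡ (x ∷ xs) {i = zero}  _         = refl
  at-++ˡ (x ∷ xs) {i = suc i} (s≤s i<n) = at-++ˡ xs i<n

  at-++ʳ : ∀ (xs : List A) {ys} i → at (xs ++ ys) (length xs + i) ≡ at ys i
  at-++ʳ []       i = refl
  at-++ʳ (x ∷ xs) i = at-++ʳ xs i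

  at-lookup : ∀ (xs : List A) {i} (i<n : i < length xs) → at xs i ≡ just (lookup xs (fromℕ< i<n))
  at-lookup (x ∷ xs) {zero}  _         = refl
  at-lookup (x ∷ xs) {suc i} (s≤s i<n) = at-lookup xs i<n

  at-ext : ∀ {xs ys : List A} → length xs ≡ length ys →
           (∀ i → i < length xs → at xs i ≡ at ys i) → xs ≡ ys
  at-ext {[]}     {[]}     _   _ = refl
  at-ext {x ∷ xs} {y ∷ ys} len agree =
    cong₂ _∷_ (just-injective (agree 0 (s≤s z≤n)))
              (at-ext (suc-injective len) (λ i i<n → agree (suc i) (s≤s i<n)))

  at-agree⇒isPrefix : ∀ {D T : List A} → length D ≤ length T →
                      (∀ i → i < length D → at D i ≡ at T i) → IsPrefix D T
  at-agree⇒isPrefix {[]}    {T}     _         _     = T , refl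
  at-agree⇒isPrefix {d ∷ D} {t ∷ T} (s≤s D≤T) agree
    with refl ← just-injective (agree 0 (s≤s z≤n))
    with R , D++R≡T ← at-agree⇒isPrefix D≤T (λ i i<n → agree (suc i) (s≤s i<n))
    = R , cong (d ∷_) D++R≡T

  take-isPrefix : ∀ n (xs : List A) → IsPrefix (take n xs) xs
  take-isPrefix n xs = drop n xs , take++drop≡id n xs

  length-take-≤ : ∀ {n} {xs : List A} → n ≤ length xs → length (take n xs) ≡ n
  length-take-≤ {n} {xs} n≤xs = trans (length-take n xs) (m≤n⇒m⊓n≡m n≤xs)

  length-^ʷ : ∀ (U : List A) k → length (U ^ʷ k) ≡ k * length U
  length-^ʷ U zero    = refl
  length-^ʷ U (suc k) = trans (length-++ U) (cong (length U +_) (length-^ʷ U k))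

  length-take-^ʷ : ∀ {T : List A} {p} U k → p ≤ length T → take p T ≡ U ^ʷ k → p ≡ k * length U
  length-take-^ʷ U k p≤T eq =
    trans (sym (length-take-≤ p≤T)) (trans (cong length eq) (length-^ʷ U k))

  length-rotate : ∀ {k} (P : List A) → k ≤ length P → length (rotate k P) ≡ length P
  length-rotate {k} P k≤P = begin
    length (drop k P ++ take k P)          ≡⟨ length-++ (drop k P) ⟩
    length (drop k P) + length (take k P)  ≡⟨ cong₂ _+_ (length-drop k P) (length-take-≤ k≤P) ⟩
    length P ∸ k + k                       ≡⟨ m∸n+n≡m k≤P ⟩
    length P                               ∎
    where open ≡-Reasoning

  Period-length : ∀ {W : List A} → W ≢ [] → Period W (length W)
  Period-length {[]}    W≢[] = ⊥-elim (W≢[] refl)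
  Period-length {x ∷ xs} _   = s≤s z≤n , ≤-refl , λ i lt → ⊥-elim (<⇒≱ lt (m≤n+m _ i))

  Period-+* : ∀ {W : List A} {p} → Period W p → ∀ q i → i + q * p < length W →
              at W (i + q * p) ≡ at W i
  Period-+* {W} _ zero i _ = cong (at W) (+-identityʳ i)
  Period-+* {W} {p} per@(_ , _ , shift) (suc q) i lt = begin
    at W (i + (p + q * p)) ≡⟨ cong (at W) reassoc ⟩
    at W (i + q * p + p)   ≡⟨ shift (i + q * p) (subst (_< length W) reassoc lt) ⟩
    at W (i + q * p)       ≡⟨ Period-+* {W} per q i (≤-<-trans (+-monoʳ-≤ i (m≤n+m (q * p) p)) lt) ⟩
    at W i                 ∎
    where
    open ≡-Reasoning
    reassoc : i + (p + q * p) ≡ i + q * p + p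
    reassoc = trans (cong (i +_) (+-comm p (q * p))) (sym (+-assoc i (q * p) p))

  Period-% : ∀ {W : List A} {p} .{{_ : NonZero p}} → Period W p → ∀ i → i < length W →
             at W i ≡ at W (i % p)
  Period-% {W} {p} per i lt =
    trans (cong (at W) i≡) (Period-+* {W} per (i / p) (i % p) (subst (_< length W) i≡ lt))
    where
    i≡ : i ≡ i % p + (i / p) * p
    i≡ = m≡m%n+[m/n]*n i p

  drop-isPrefix⇒Period : ∀ {T : List A} {k} → 0 < k → k ≤ length T → IsPrefix (drop k T) T → Period T k
  drop-isPrefix⇒Period {T} {k} 0<k k≤T (R , D++R≡T) = 0<k , k≤T , λ i i+k<T → begin
    at T (i + k)              ≡⟨ cong (at T) (+-comm i k) ⟩
    at T (k + i)              ≡⟨ at-drop k T i ⟨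
    at (drop k T) i           ≡⟨ at-++ˡ (drop k T) (i<D i+k<T) ⟨
    at (drop k T ++ R) i      ≡⟨ cong (λ L → at L i) D++R≡T ⟩
    at T i                    ∎
    where
    open ≡-Reasoning
    i<D : ∀ {i} → i + k < length T → i < length (drop k T)
    i<D {i} i+k<T = subst (i <_) (sym (length-drop k T))
                          (subst (_< length T ∸ k) (m+n∸n≡m i k) (∸-monoˡ-< i+k<T (m≤n+m k i)))

  ωat : List A → ℕ → Maybe A
  ωat []       _ = nothing
  ωat (x ∷ xs) i = just (ω x xs i)

  ωat-% : ∀ {U : List A} {n} .{{_ : NonZero n}} → length U ≡ n → ∀ i → ωat U i ≡ at U (i % n)
  ωat-% {[]}     {n} 0≡n _ = ⊥-elim (≢-nonZero⁻¹ n (sym 0≡n))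
  ωat-% {x ∷ xs} refl    i = sym (at-lookup (x ∷ xs) (m%n<n i (length (x ∷ xs))))

  ωat-cong-% : ∀ (U : List A) .{{_ : NonZero (length U)}} i j →
               i % length U ≡ j % length U → ωat U i ≡ ωat U j
  ωat-cong-% U i j i≡j = trans (ωat-% refl i) (trans (cong (at U) i≡j) (sym (ωat-% refl j)))

  ωat-< : ∀ (U : List A) {i} → i < length U → ωat U i ≡ at U i
  ωat-< (x ∷ xs) {i} i<U = trans (ωat-% refl i) (cong (at (x ∷ xs)) (m<n⇒m%n≡m i<U))

  ωat-+ : ∀ (U : List A) i → ωat U (length U + i) ≡ ωat U i
  ωat-+ []       i = refl
  ωat-+ (x ∷ xs) i = ωat-cong-% (x ∷ xs) (n + i) i (trans (cong (_% n) (+-comm n i)) ([m+n]%n≡m%n i n))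
    where
    n : ℕ
    n = length (x ∷ xs)

  infix 4 _⊑ω[_]_ _⊑ω_
  record _⊑ω[_]_ (X : List A) (o : ℕ) (U : List A) : Set a where
    field at≡ωat : ∀ i → i < length X → at X i ≡ ωat U (o + i)
  open _⊑ω[_]_ public

  _⊑ω_ : List A → List A → Set a
  X ⊑ω U = X ⊑ω[ 0 ] U

  ⊑ω-refl : ∀ {U : List A} → U ⊑ω U
  ⊑ω-refl {U} .at≡ωat i i<U = sym (ωat-< U i<U)

  take⊑ω : ∀ {U : List A} r → take r U ⊑ω U
  take⊑ω {U} r .at≡ωat i i<take = trans (at-take r U (<-≤-trans i<r⊓U (m⊓n≤m r (length U))))
                                        (at≡ωat ⊑ω-refl i (<-≤-trans i<r⊓U (m⊓n≤n r (length U))))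
    where
    i<r⊓U : i < r ⊓ length U
    i<r⊓U = subst (i <_) (length-take r U) i<take

  drop⊑ω[] : ∀ {X U : List A} {o} k → X ⊑ω[ o ] U → drop k X ⊑ω[ o + k ] U
  drop⊑ω[] {X} {U} {o} k X⊑U .at≡ωat i i<D = begin
    at (drop k X) i      ≡⟨ at-drop k X i ⟩
    at X (k + i)         ≡⟨ at≡ωat X⊑U (k + i) k+i<X ⟩
    ωat U (o + (k + i))  ≡⟨ cong (ωat U) (+-assoc o k i) ⟨
    ωat U (o + k + i)    ∎
    where
    open ≡-Reasoning
    i<X∸k : i < length X ∸ k
    i<X∸k = subst (i <_) (length-drop k X) i<D
    k+i<X : k + i < length X
    k+i<X = subst (k + i <_) (m+[n∸m]≡n (<⇒≤ k<X)) (+-monoʳ-< k i<X∸k)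
      where
      k<X : k < length X
      k<X = m∸n≢0⇒n<m λ X∸k≡0 → <⇒≱ i<X∸k (subst (_≤ i) (sym X∸k≡0) z≤n)

  ⊑ω[]-+length : ∀ {X U : List A} {o} → X ⊑ω[ o ] U → X ⊑ω[ o + length U ] U
  ⊑ω[]-+length {X} {U} {o} X⊑U .at≡ωat i i<X = begin
    at X i                       ≡⟨ at≡ωat X⊑U i i<X ⟩
    ωat U (o + i)                ≡⟨ ωat-+ U (o + i) ⟨
    ωat U (length U + (o + i))   ≡⟨ cong (ωat U) reassoc ⟩
    ωat U (o + length U + i)     ∎
    where
    open ≡-Reasoning
    reassoc : length U + (o + i) ≡ o + length U + i
    reassoc = trans (sym (+-assoc (length U) o i)) (cong (_+ i) (+-comm (length U) o))

  ++⊑ω[] : ∀ {X Y U : List A} {o} → X ⊑ω[ o ] U → Y ⊑ω[ o + length X ] U → X ++ Y ⊑ω[ o ] U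
  ++⊑ω[] {X} {Y} {U} {o} X⊑U Y⊑U .at≡ωat i i<XY with i <? length X
  ... | yes i<X = trans (at-++ˡ X i<X) (at≡ωat X⊑U i i<X)
  ... | no  i≮X = begin
    at (X ++ Y) i               ≡⟨ cong (at (X ++ Y)) X+t≡i ⟨
    at (X ++ Y) (length X + t)  ≡⟨ at-++ʳ X t ⟩
    at Y t                      ≡⟨ at≡ωat Y⊑U t t<Y ⟩
    ωat U (o + length X + t)    ≡⟨ cong (ωat U) (trans (+-assoc o (length X) t) (cong (o +_) X+t≡i)) ⟩
    ωat U (o + i)               ∎
    where
    open ≡-Reasoning
    t : ℕ
    t = i ∸ length X
    X+t≡i : length X + t ≡ i
    X+t≡i = m+[n∸m]≡n (≮⇒≥ i≮X)
    t<Y : t < length Y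
    t<Y = +-cancelˡ-< (length X) t (length Y) (subst₂ _<_ (sym X+t≡i) (length-++ X) i<XY)

  ^ʷ-++⊑ω : ∀ {U Y : List A} k → Y ⊑ω U → U ^ʷ k ++ Y ⊑ω U
  ^ʷ-++⊑ω         zero    Y⊑U = Y⊑U
  ^ʷ-++⊑ω {U} {Y} (suc k) Y⊑U = subst (_⊑ω U) (sym (++-assoc U (U ^ʷ k) Y))
                                      (++⊑ω[] ⊑ω-refl (⊑ω[]-+length (^ʷ-++⊑ω k Y⊑U)))

  ^ʷ⊑ω : ∀ {U : List A} k → U ^ʷ k ⊑ω U
  ^ʷ⊑ω {U} k = subst (_⊑ω U) (++-identityʳ (U ^ʷ k)) (^ʷ-++⊑ω k record { at≡ωat = λ _ () })

  rotate⊑ω[] : ∀ {P : List A} {k} → k ≤ length P → rotate k P ⊑ω[ k ] P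
  rotate⊑ω[] {P} {k} k≤P = ++⊑ω[] (drop⊑ω[] k ⊑ω-refl)
                                  (subst (take k P ⊑ω[_] P) P≡k+D (⊑ω[]-+length (take⊑ω k)))
    where
    P≡k+D : length P ≡ k + length (drop k P)
    P≡k+D = trans (sym (m+[n∸m]≡n k≤P)) (cong (k +_) (sym (length-drop k P)))

  ⊑ω-ωat : ∀ {X U : List A} {o} → X ⊑ω[ o ] U → ∀ {i} → i < length X → ωat X i ≡ ωat U (o + i)
  ⊑ω-ωat {X} X⊑U {i} i<X = trans (ωat-< X i<X) (at≡ωat X⊑U i i<X)

  ⊑ω[]-∣⇒ωat : ∀ {X U : List A} {o} .{{_ : NonZero (length X)}} → X ⊑ω[ o ] U →
               length U ∣ length X → ∀ i → ωat X i ≡ ωat U (o + i)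
  ⊑ω[]-∣⇒ωat {[]}                        _   _ _ = ⊥-elim (≢-nonZero⁻¹ 0 refl)
  ⊑ω[]-∣⇒ωat {x ∷ xs} {[]}               X⊑U _ _ with () ← at≡ωat X⊑U 0 (s≤s z≤n)
  ⊑ω[]-∣⇒ωat {X@(_ ∷ _)} {U@(_ ∷ _)} {o} X⊑U U∣X i = begin
    ωat X i                ≡⟨ ωat-% refl i ⟩
    at X (i % N)           ≡⟨ at≡ωat X⊑U (i % N) (m%n<n i N) ⟩
    ωat U (o + i % N)      ≡⟨ ωat-cong-% U (o + i % N) (o + i) shift-mod ⟩
    ωat U (o + i)          ∎
    where
    open ≡-Reasoning
    N n : ℕ
    N = length X
    n = length U
    shift-mod : (o + i % N) % n ≡ (o + i) % n
    shift-mod = begin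
      (o + i % N) % n          ≡⟨ %-distribˡ-+ o (i % N) n ⟩
      (o % n + i % N % n) % n  ≡⟨ cong (λ r → (o % n + r) % n) (m∣n⇒o%n%m≡o%m n N i U∣X) ⟩
      (o % n + i % n) % n      ≡⟨ %-distribˡ-+ o i n ⟨
      (o + i) % n              ∎

  ωat-rotate : ∀ {P : List A} {k} → k ≤ length P → ∀ i → ωat (rotate k P) i ≡ ωat P (k + i)
  ωat-rotate {[]}     z≤n _ = refl
  ωat-rotate {P@(_ ∷ _)} {k} k≤P = ⊑ω[]-∣⇒ωat {{R≢0}} (rotate⊑ω[] k≤P) (divides 1 R≡1*P)
    where
    R≡P : length (rotate k P) ≡ length P
    R≡P = length-rotate P k≤P
    R≡1*P : length (rotate k P) ≡ 1 * length P
    R≡1*P = trans R≡P (sym (*-identityˡ (length P)))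
    R≢0 : NonZero (length (rotate k P))
    R≢0 = >-nonZero (subst (0 <_) (sym R≡P) (s≤s z≤n))

  drop⊑ω-rotate : ∀ {T P : List A} {k} → T ⊑ω P → k ≤ length P → drop k T ⊑ω rotate k P
  drop⊑ω-rotate {T} {P} {k} T⊑P k≤P .at≡ωat i i<D =
    trans (at≡ωat (drop⊑ω[] k T⊑P) i i<D) (sym (ωat-rotate k≤P i))

  ⊑ω-unique : ∀ {X Y U : List A} → X ⊑ω U → Y ⊑ω U → length X ≡ length Y → X ≡ Y
  ⊑ω-unique X⊑U Y⊑U X≡Y =
    at-ext X≡Y λ i i<X → trans (at≡ωat X⊑U i i<X) (sym (at≡ωat Y⊑U i (subst (i <_) X≡Y i<X)))

  ⊑ω⇒isPrefix : ∀ {D T : List A} → D ⊑ω T → length D ≤ length T → IsPrefix D T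
  ⊑ω⇒isPrefix {D} {T} D⊑T D≤T =
    at-agree⇒isPrefix D≤T λ i i<D → trans (at≡ωat D⊑T i i<D) (ωat-< T (<-≤-trans i<D D≤T))

  ⊑ω⇒Period : ∀ {X U : List A} → X ⊑ω U → 0 < length U → length U ≤ length X → Period X (length U)
  ⊑ω⇒Period {X} {U} X⊑U 0<U U≤X = 0<U , U≤X , λ i i+U<X → begin
    at X (i + length U)    ≡⟨ at≡ωat X⊑U _ i+U<X ⟩
    ωat U (i + length U)   ≡⟨ cong (ωat U) (+-comm i (length U)) ⟩
    ωat U (length U + i)   ≡⟨ ωat-+ U i ⟩
    ωat U i                ≡⟨ at≡ωat X⊑U i (≤-<-trans (m≤m+n i (length U)) i+U<X) ⟨
    at X i                 ∎
    where open ≡-Reasoning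

  Period⇒⊑ω-take : ∀ {T : List A} {p} → Period T p → T ⊑ω take p T
  Period⇒⊑ω-take {T} {p} per@(0<p , p≤T , _) .at≡ωat i i<T = begin
    at T i                 ≡⟨ Period-% {T} per i i<T ⟩
    at T (i % p)           ≡⟨ at-take p T (m%n<n i p) ⟨
    at (take p T) (i % p)  ≡⟨ ωat-% (length-take-≤ p≤T) i ⟨
    ωat (take p T) i       ∎
    where
    open ≡-Reasoning
    instance
      p≢0 : NonZero p
      p≢0 = >-nonZero 0<p

  Period⇒≡^ʷ++take : ∀ {T : List A} {p} .{{_ : NonZero p}} → Period T p →
                     T ≡ take p T ^ʷ (length T / p) ++ take (length T % p) (take p T)
  Period⇒≡^ʷ++take {T} {p} per@(_ , p≤T , _) =
    ⊑ω-unique (Period⇒⊑ω-take per) (^ʷ-++⊑ω q (take⊑ω r)) (begin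
      length T                             ≡⟨ m≡m%n+[m/n]*n (length T) p ⟩
      r + q * p                            ≡⟨ +-comm r (q * p) ⟩
      q * p + r                            ≡⟨ cong₂ _+_ |P^q| (length-take-≤ r≤P) ⟨
      length (P ^ʷ q) + length (take r P)  ≡⟨ length-++ (P ^ʷ q) ⟨
      length (P ^ʷ q ++ take r P)          ∎)
    where
    open ≡-Reasoning
    P : List A
    P = take p T
    q r : ℕ
    q = length T / p
    r = length T % p
    |P^q| : length (P ^ʷ q) ≡ q * p
    |P^q| = trans (length-^ʷ P q) (cong (q *_) (length-take-≤ p≤T))
    r≤P : r ≤ length P
    r≤P = subst (r ≤_) (sym (length-take-≤ p≤T)) (<⇒≤ (m%n<n (length T) p))

  Period-^ʷ-root : ∀ {T : List A} {p} U k → Period T p → take p T ≡ U ^ʷ suc k → Period T (length U)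
  Period-^ʷ-root {T} {p} U k per@(0<p , p≤T , _) P≡U^k = ⊑ω⇒Period T⊑U 0<U (≤-trans U≤p p≤T)
    where
    p≡ : p ≡ suc k * length U
    p≡ = length-take-^ʷ U (suc k) p≤T P≡U^k
    instance
      P≢0 : NonZero (length (take p T))
      P≢0 = >-nonZero (subst (0 <_) (sym (length-take-≤ p≤T)) 0<p)
    P⊑U : take p T ⊑ω U
    P⊑U = subst (_⊑ω U) (sym P≡U^k) (^ʷ⊑ω {U = U} (suc k))
    T⊑U : T ⊑ω U
    T⊑U .at≡ωat i i<T = trans (at≡ωat (Period⇒⊑ω-take per) i i<T)
                      (⊑ω[]-∣⇒ωat P⊑U (divides (suc k) (trans (length-take-≤ p≤T) p≡)) i)
    U≤p : length U ≤ p
    U≤p = subst (length U ≤_) (sym p≡) (m≤m+n (length U) (k * length U))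
    0<U : 0 < length U
    0<U = n≢0⇒n>0 λ U≡0 → <⇒≢ 0<p (sym (trans p≡ (trans (cong (suc k *_) U≡0) (*-zeroʳ (suc k)))))

  shortestEvenPeriod-^ʷ-root : ∀ {T : List A} {pe} U k → Period T pe →
                               (∀ q → Even q → Period T q → pe ≤ q) →
                               take pe T ≡ U ^ʷ k → 2 ≤ k →
                               Odd (length U) × Period T (length U) × 2 * length U ≤ pe
  shortestEvenPeriod-^ʷ-root {T} {pe} U (suc k) per shortest P≡U^k 2≤k =
    odd , perU , 2U≤pe
    where
    perU : Period T (length U)
    perU = Period-^ʷ-root U k per P≡U^k
    2U≤pe : 2 * length U ≤ pe
    2U≤pe = subst (2 * length U ≤_) (sym (length-take-^ʷ U (suc k) (proj₁ (proj₂ per)) P≡U^k))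
                  (*-monoˡ-≤ (length U) 2≤k)
    U<2U : length U < 2 * length U
    U<2U = m<m+n (length U) (subst (0 <_) (sym (+-identityʳ (length U))) (proj₁ perU))
    odd : Odd (length U)
    odd even = <⇒≱ (<-≤-trans U<2U 2U≤pe) (shortest (length U) even perU)

module _ {a ℓ : Level} {A : Set a} (_⊏_ : Rel A ℓ) where

  private
    infix 4 _≺_
    _≺_ : List A → List A → Set (a ⊔ ℓ)
    _≺_ = _≺alt_ _⊏_

  infix 4 _⊏ᴹ_
  _⊏ᴹ_ : Maybe A → Maybe A → Set ℓ
  just u ⊏ᴹ just v = u ⊏ v
  _      ⊏ᴹ _      = Lift ℓ ⊥

  AltWitness : List A → List A → ℕ → Set (a ⊔ ℓ)
  AltWitness X Y i = (∀ m → m < i → ωat X m ≡ ωat Y m)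
                   × (Even i × ωat X i ⊏ᴹ ωat Y i ⊎ Odd i × ωat Y i ⊏ᴹ ωat X i)

  ≺alt⇒AltWitness : ∀ X Y → 0 < length Y → X ≺ Y → ∃ (AltWitness X Y)
  ≺alt⇒AltWitness []       _        _  (lift ())
  ≺alt⇒AltWitness (_ ∷ _)  []       () _
  ≺alt⇒AltWitness (x ∷ xs) (y ∷ ys) _  (i , agree , differ) =
    i , (λ m m<i → cong just (agree m m<i)) , differ

  AltWitness⇒≺alt : ∀ X Y {i} → AltWitness X Y i → X ≺ Y
  AltWitness⇒≺alt []       _        (_ , inj₁ (_ , lift ()))
  AltWitness⇒≺alt []       []       (_ , inj₂ (_ , lift ()))
  AltWitness⇒≺alt []       (_ ∷ _)  (_ , inj₂ (_ , lift ()))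
  AltWitness⇒≺alt (_ ∷ _)  []       _ = lift tt
  AltWitness⇒≺alt (x ∷ xs) (y ∷ ys) {i} (agree , differ) =
    i , (λ m m<i → just-injective (agree m m<i)) , differ

  AltWitness-transfer : ∀ {X Y Z W i} → (∀ m → m ≤ i → ωat X m ≡ ωat Z m) →
                        (∀ m → m ≤ i → ωat Y m ≡ ωat W m) → AltWitness X Y i → AltWitness Z W i
  AltWitness-transfer {i = i} X≈Z Y≈W (agree , differ) =
    (λ m m<i → trans (sym (X≈Z m (<⇒≤ m<i))) (trans (agree m m<i) (Y≈W m (<⇒≤ m<i))))
    , Sum.map (Product.map₂ (subst₂ _⊏ᴹ_ (X≈Z i ≤-refl) (Y≈W i ≤-refl)))
              (Product.map₂ (subst₂ _⊏ᴹ_ (Y≈W i ≤-refl) (X≈Z i ≤-refl))) differ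

  PreGalois⇒Galois-take : ∀ {T : List A} {p} → PreGalois _⊏_ T → Period T p →
                          (∀ k → 0 < k → k < p → ¬ Period T k) → Galois _⊏_ (take p T)
  PreGalois⇒Galois-take {T} {p} preGalois per@(_ , p≤T , _) noShorter k 0<k k<P =
    [ ⊥-elim ∘ D-not-prefix , rotation-smaller ]′ (preGalois k 0<k k≤T)
    where
    P D R : List A
    P = take p T
    D = drop k T
    R = rotate k P
    k<p : k < p
    k<p = subst (k <_) (length-take-≤ p≤T) k<P
    k≤T : k ≤ length T
    k≤T = ≤-trans (<⇒≤ k<p) p≤T
    D≤T : length D ≤ length T
    D≤T = subst (_≤ length T) (sym (length-drop k T)) (m∸n≤m (length T) k)
    0<D : 0 < length D
    0<D = subst (0 <_) (sym (length-drop k T)) (m<n⇒0<n∸m (<-≤-trans k<p p≤T))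
    D-not-prefix : ¬ IsPrefix D T
    D-not-prefix = noShorter k 0<k k<p ∘ drop-isPrefix⇒Period 0<k k≤T
    T⊑P : T ⊑ω P
    T⊑P = Period⇒⊑ω-take per
    D⊑R : D ⊑ω R
    D⊑R = drop⊑ω-rotate T⊑P (<⇒≤ k<P)
    rotation-smaller : T ≺ D → P ≺ R
    rotation-smaller T≺D with ≺alt⇒AltWitness T D 0<D T≺D
    ... | i , witness@(agree , _) with i <? length D
    ...   | yes i<D = AltWitness⇒≺alt P R (AltWitness-transfer T≈P D≈R witness)
      where
      T≈P : ∀ m → m ≤ i → ωat T m ≡ ωat P m
      T≈P m m≤i = ⊑ω-ωat T⊑P (<-≤-trans (≤-<-trans m≤i i<D) D≤T)
      D≈R : ∀ m → m ≤ i → ωat D m ≡ ωat R m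
      D≈R m m≤i = ⊑ω-ωat D⊑R (≤-<-trans m≤i i<D)
    ...   | no  i≮D = ⊥-elim (D-not-prefix (⊑ω⇒isPrefix D⊑T D≤T))
      where
      D⊑T : D ⊑ω T
      D⊑T .at≡ωat m m<D = trans (sym (ωat-< D m<D)) (sym (agree m (<-≤-trans m<D (≮⇒≥ i≮D))))

lemma15 : ∀ {a ℓ : Level} {A : Set a} {_<_ : Rel A ℓ} →
            IsStrictTotalOrder _≡_ _<_ →
            (T : List A) → T ≢ [] → Even (length T) → PreGalois _<_ T →
            (pe : ℕ) → IsPerE T pe → ¬ Primitive (take pe T) →
            (po : ℕ) → IsPerO T po →
            GaloisRoot _<_ T (take po T) × Odd (length (take po T))
            × (∃[ k ] ((2 ≤ k) × (∃[ G′ ] (IsPrefix G′ (take po T)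
                 × (T ≡ (take po T ^ʷ k) ++ G′)))))
lemma15 _ T T≢[] evenT _ _ (inj₂ (noEven , _)) _ _ _ =
  ⊥-elim (noEven (length T) evenT (Period-length T≢[]))
lemma15 _ T _ _ _ _ (inj₁ (_ , pePer , peMin)) notPrim _ (inj₂ (noOdd , _)) =
  ⊥-elim (notPrim λ U k 2≤k P≡U^k →
    let odd , perU , _ = shortestEvenPeriod-^ʷ-root U k pePer peMin P≡U^k 2≤k in noOdd _ odd perU)
lemma15 _ T _ _ preGalois pe (inj₁ (_ , pePer , peMin)) notPrim po (inj₁ (poOdd , poPer , poMin)) =
  ( take-isPrefix po T
  , subst (Period T) (sym |P|≡po) poPer
  , PreGalois⇒Galois-take _ preGalois poPer noShorter)
  , subst Odd (sym |P|≡po) poOdd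
  , length T / po , 2≤q , take (length T % po) (take po T) , take-isPrefix _ _ , Period⇒≡^ʷ++take poPer
  where
  instance
    po≢0 : NonZero po
    po≢0 = >-nonZero (proj₁ poPer)
  |P|≡po : length (take po T) ≡ po
  |P|≡po = length-take-≤ (proj₁ (proj₂ poPer))
  -- ¬ Primitive only refutes decompositions, so the bound is obtained by stability of decidable ≤.
  2po≤pe : 2 * po ≤ pe
  2po≤pe = decidable-stable (2 * po ≤? pe) λ 2po≰pe → notPrim λ U k 2≤k P≡U^k →
    let odd , perU , 2U≤pe = shortestEvenPeriod-^ʷ-root U k pePer peMin P≡U^k 2≤k
    in 2po≰pe (≤-trans (*-monoʳ-≤ 2 (poMin _ odd perU)) 2U≤pe)
  noShorter : ∀ k → 0 < k → k < po → ¬ Period T k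
  noShorter k _ k<po perk with 2 ∣? k
  ... | yes even = <⇒≱ (<-≤-trans k<po (≤-trans (m≤m+n po _) 2po≤pe)) (peMin k even perk)
  ... | no  odd  = <⇒≱ k<po (poMin k odd perk)
  2≤q : 2 ≤ length T / po
  2≤q = subst (_≤ length T / po) (m*n/n≡m 2 po)
              (/-monoˡ-≤ po (≤-trans 2po≤pe (proj₁ (proj₂ pePer))))
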